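{- Let $D$ be a digraph of order $n\geq 6$ with minimum in-degree and minimum out-degree at least two, such that $\min\{d(x),d(y)\}\geq n-1$ and $d(x)+d(y)\geq 2n-1$ for every pair of non-adjacent vertices $x,y$ with a common in-neighbour. Let $C:=x_1x_2\ldots x_{n-1}x_1$ be any cycle of length $n-1$ in $D$ (indices modulo $n-1$) and let $y$ be the vertex not on $C$. Then for any $i\in[1,n-1]$: (i) If $yx_i\notin D$ and $x_{i-2}x_i\notin D$, then $x_i$ has a partner on $C[x_{i+1},x_{i-2}]$ or $d(x_i)\geq n-1$. (ii) If $yx_i\notin D$ and $d(x_i)\leq n-2$, then $x_i$ has a partner on $C[x_{i+1},x_{i-2}]$ or there is a vertex $x_k\in C[x_{i+1},x_{i-2}]$ such that every vertex of $\{x_k,x_{k+1},\ldots,x_{i-2}\}$ dominates $x_i$. (iii) If $yx_i\in D$, $x_{i-2}x_i\notin D$ and $d^-(x_i)\geq 3$, then $x_i$ has a partner on $C[x_{i+1},x_{i-1}]$ or $d(x_i)\geq n-1$.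
   Context: Digraphs are finite, without loops or multiple arcs; $uv\in D$ means $uv$ is an arc. Two distinct vertices are adjacent if $uv$ or $vu$ is an arc. $d^+,d^-$ are out-/in-degree and $d(x)=d^+(x)+d^-(x)$. A common in-neighbour of $x,y$ is a vertex $z$ with $zx,zy\in D$. For vertices $x_a,x_b$ of the cycle $C$, $C[x_a,x_b]$ denotes the path $x_ax_{a+1}\ldots x_b$ along $C$. A vertex $x$ not on a path $P=z_1z_2\ldots z_m$ has a partner on $P$ if there is $j\in[1,m-1]$ with $z_jx, xz_{j+1}\in D$. A vertex $u$ dominates $v$ if $uv\in D$. -}

module Defs where

open import Data.Nat using (ℕ; suc; _+_; _∸_; _≤_; _<_; _⊓_; _*_)
open import Data.Fin using (Fin)
open import Data.List using (List; length; filter; allFin)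
open import Data.Product using (_×_; ∃-syntax)
open import Data.Sum using (_⊎_)
open import Relation.Nullary using (¬_)
open import Relation.Binary using (Decidable)
open import Relation.Binary.PropositionalEquality using (_≡_; _≢_)

-- Arcs are a decidable relation; "no multiple arcs" is automatic since
-- there is at most one arc relation per ordered pair.
record Digraph (n : ℕ) : Set₁ where
  field
    _⇒_   : Fin n → Fin n → Set
    _⇒?_  : Decidable _⇒_
    loopless : ∀ v → ¬ (v ⇒ v)

module _ {n : ℕ} (D : Digraph n) where
  open Digraph D

  outdeg : Fin n → ℕ
  outdeg v = length (filter (v ⇒?_) (allFin n))

  indeg : Fin n → ℕ
  indeg v = length (filter (λ u → u ⇒? v) (allFin n))

  deg : Fin n → ℕ
  deg v = outdeg v + indeg v

  Adjacent : Fin n → Fin n → Set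
  Adjacent u v = (u ⇒ v) ⊎ (v ⇒ u)

  CommonInNeighbour : Fin n → Fin n → Set
  CommonInNeighbour u v = ∃[ z ] ((z ⇒ u) × (z ⇒ v))

  DegreeCondition : Set
  DegreeCondition =
    ∀ u v → u ≢ v → ¬ Adjacent u v → CommonInNeighbour u v →
      (n ∸ 1 ≤ deg u ⊓ deg v) × (2 * n ∸ 1 ≤ deg u + deg v)

  -- x : ℕ → Fin n is a cycle x_0 x_1 ... x_{L-1} x_0 of length L, with
  -- indices read modulo L (x is L-periodic).
  IsCycle : (L : ℕ) → (ℕ → Fin n) → Set
  IsCycle L x =
    (∀ k → x (k + L) ≡ x k) ×
    (∀ j k → j < L → k < L → x j ≡ x k → j ≡ k) ×
    (∀ k → x k ⇒ x (suc k))

  -- v has a partner on the path z_1 ... z_m where z_t = x (a + t):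
  -- some j ∈ [1, m-1] with z_j v, v z_{j+1} arcs.
  PartnerOnPath : (x : ℕ → Fin n) (a m : ℕ) (v : Fin n) → Set
  PartnerOnPath x a m v =
    ∃[ j ] ((1 ≤ j) × (j ≤ m ∸ 1) × (x (a + j) ⇒ v) × (v ⇒ x (a + suc j)))

module Submission where

-- Let C = x₁ … x_{n-1} x₁ be a cycle of length n-1 missing the vertex y, and
-- write x (i + j) for the vertex j steps after x i along C.  Suppose
-- x_{i-2} = x (i + (n-3)) does not dominate x i and scan the path
-- x (i+1) … x (i+n-4) for in-neighbours of x i.
--   * If there is one, take the LAST one, x (i+l).  Its successor x (i+l+1)
--     does not dominate x i; either x i dominates it (x i has a partner) or
--     x i and x (i+l+1) are non-adjacent with the common in-neighbour
--     x (i+l), so the degree condition gives d(x i) ≥ n-1.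
--   * If there is none, every in-neighbour of x i is y or x_{i-1}, which
--     contradicts d⁻(x i) ≥ 2 when yx i ∉ D, and contradicts d⁻(x i) ≥ 3.
-- This dichotomy yields (i) and (iii) directly, and (ii) follows from (i)
-- unless x_{i-2} dominates x i, in which case k = i-2 works.

open import Defs
open import Data.Nat using (ℕ; zero; suc; _+_; _*_; _∸_; _≤_; _<_; z≤n; s≤s; z<s; _≤?_; _<?_; NonZero)
open import Data.Nat.Properties
open import Data.Nat.DivMod using (_%_; _/_; m≡m%n+[m/n]*n; m%n<n)
open import Algebra.Properties.CommutativeSemigroup +-commutativeSemigroup using (x∙yz≈xz∙y; xy∙z≈xz∙y)
open import Data.Fin as F using (Fin; toℕ)
open import Data.Fin.Properties using (any?; injective⇒≤; toℕ-injective; toℕ<n)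
open import Data.List using (List; []; _∷_; length; filter; allFin)
open import Data.List.Membership.Propositional using (_∈_)
open import Data.List.Membership.Propositional.Properties using (∈-filter⁻)
open import Data.List.Relation.Unary.Any using (here; there)
open import Data.List.Relation.Unary.All as All using ()
open import Data.List.Relation.Unary.AllPairs using (_∷_)
open import Data.List.Relation.Unary.Unique.Propositional using (Unique)
open import Data.List.Relation.Unary.Unique.Propositional.Properties using (filter⁺; allFin⁺)
open import Data.Product using (_×_; ∃-syntax; _,_; proj₁; proj₂)
open import Data.Sum using (_⊎_; inj₁; inj₂; swap)
open import Data.Empty using (⊥-elim)
open import Function using (_∘_)
open import Function.Definitions using (Injective)
open import Relation.Nullary using (¬_; Dec; yes; no)
open import Relation.Binary.Definitions using (tri<; tri≈; tri>)
open import Relation.Binary.PropositionalEquality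

module _ {A : Set} where

  unique-within-one : ∀ {a : A} (xs : List A) → Unique xs →
    (∀ {v} → v ∈ xs → v ≡ a) → length xs ≤ 1
  unique-within-one []           _                  _    = z≤n
  unique-within-one (_ ∷ [])     _                  _    = s≤s z≤n
  unique-within-one (u ∷ w ∷ _) ((u≢w All.∷ _) ∷ _) in-a =
    ⊥-elim (u≢w (trans (in-a (here refl)) (sym (in-a (there (here refl))))))

  other-value : ∀ {u v c d : A} → u ≡ c → u ≢ v → v ≡ c ⊎ v ≡ d → v ≡ d
  other-value u≡c u≢v (inj₁ v≡c) = ⊥-elim (u≢v (trans u≡c (sym v≡c)))
  other-value _   _   (inj₂ v≡d) = v≡d

  unique-within-two : ∀ {a b : A} (xs : List A) → Unique xs →
    (∀ {v} → v ∈ xs → v ≡ a ⊎ v ≡ b) → length xs ≤ 2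
  unique-within-two []       _             _     = z≤n
  unique-within-two (u ∷ xs) (u∉xs ∷ uniq) in-ab with in-ab (here refl)
  ... | inj₁ u≡a = s≤s (unique-within-one xs uniq λ v∈ →
          other-value u≡a (All.lookup u∉xs v∈) (in-ab (there v∈)))
  ... | inj₂ u≡b = s≤s (unique-within-one xs uniq λ v∈ →
          other-value u≡b (All.lookup u∉xs v∈) (swap (in-ab (there v∈))))

module _ {n : ℕ} (D : Digraph n) where
  open Digraph D

  private
    InNeighbours : Fin n → List (Fin n)
    InNeighbours v = filter (λ u → u ⇒? v) (allFin n)

    in-neighbours-unique : ∀ v → Unique (InNeighbours v)
    in-neighbours-unique v = filter⁺ (λ u → u ⇒? v) (allFin⁺ n)

    in-neighbour : ∀ {u v} → u ∈ InNeighbours v → u ⇒ v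
    in-neighbour {v = v} u∈ = proj₂ (∈-filter⁻ (λ u → u ⇒? v) {xs = allFin n} u∈)

  indeg-≤1 : ∀ {v} a → (∀ {u} → u ⇒ v → u ≡ a) → indeg D v ≤ 1
  indeg-≤1 {v} _ only-a =
    unique-within-one (InNeighbours v) (in-neighbours-unique v) (only-a ∘ in-neighbour)

  indeg-≤2 : ∀ {v} a b → (∀ {u} → u ⇒ v → u ≡ a ⊎ u ≡ b) → indeg D v ≤ 2
  indeg-≤2 {v} _ _ only-ab =
    unique-within-two (InNeighbours v) (in-neighbours-unique v) (only-ab ∘ in-neighbour)

  partner-extend : ∀ {x a len v} → PartnerOnPath D x a len v → PartnerOnPath D x a (suc len) v
  partner-extend {len = len} (j , 1≤j , j≤ , into , out) =
    j , 1≤j , ≤-trans j≤ (∸-monoˡ-≤ 1 (n≤1+n len)) , into , out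

module _ {P : ℕ → Set} (P? : ∀ j → Dec (P j)) where

  private
    extend-none : ∀ {b} → (∀ j → 1 ≤ j → j ≤ b → ¬ P j) → ¬ P (suc b) →
      ∀ j → 1 ≤ j → j ≤ suc b → ¬ P j
    extend-none none ¬P j 1≤j j≤ with m≤n⇒m<n∨m≡n j≤
    ... | inj₁ j<  = none j 1≤j (≤-pred j<)
    ... | inj₂ refl = ¬P

  last-witness : ∀ b → ¬ P (suc b) →
    (∀ j → 1 ≤ j → j ≤ suc b → ¬ P j) ⊎ ∃[ l ] (1 ≤ l × l ≤ b × P l × ¬ P (suc l))
  last-witness zero ¬P = inj₁ (extend-none (λ j 1≤j j≤0 _ → <⇒≱ 1≤j j≤0) ¬P)
  last-witness (suc b) ¬P with P? (suc b)
  ... | yes p = inj₂ (suc b , s≤s z≤n , ≤-refl , p , ¬P)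
  ... | no ¬p with last-witness b ¬p
  ...   | inj₁ none = inj₁ (extend-none none ¬P)
  ...   | inj₂ (l , 1≤l , l≤b , p , ¬p′) = inj₂ (l , 1≤l , m≤n⇒m≤1+n l≤b , p , ¬p′)

module PeriodicSequence {A : Set} (m : ℕ) .{{_ : NonZero m}} (x : ℕ → A)
  (periodic : ∀ k → x (k + m) ≡ x k)
  (injective : ∀ j l → j < m → l < m → x j ≡ x l → j ≡ l) where

  private
    periodic-multiple : ∀ q k → x (k + q * m) ≡ x k
    periodic-multiple zero    k = cong x (+-identityʳ k)
    periodic-multiple (suc q) k = begin
      x (k + (m + q * m)) ≡⟨ cong x (x∙yz≈xz∙y k m (q * m)) ⟩
      x (k + q * m + m)   ≡⟨ periodic (k + q * m) ⟩
      x (k + q * m)       ≡⟨ periodic-multiple q k ⟩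
      x k                 ∎
      where open ≡-Reasoning

    reduce : ∀ a d → x (a + d) ≡ x (a % m + d)
    reduce a d = begin
      x (a + d)                   ≡⟨ cong (λ k → x (k + d)) (m≡m%n+[m/n]*n a m) ⟩
      x (a % m + a / m * m + d)   ≡⟨ cong x (xy∙z≈xz∙y (a % m) (a / m * m) d) ⟩
      x (a % m + d + a / m * m)   ≡⟨ periodic-multiple (a / m) (a % m + d) ⟩
      x (a % m + d)               ∎
      where open ≡-Reasoning

    -- From a position r < m, a forward step 0 < d < m either stays below m
    -- or wraps around to a position strictly below r.
    apart-from-reduced : ∀ r d → r < m → 0 < d → d < m → x r ≢ x (r + d)
    apart-from-reduced r d r<m 0<d d<m eq with r + d <? m
    ... | yes r+d<m = <⇒≢ (m<m+n r 0<d) (injective r (r + d) r<m r+d<m eq)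
    ... | no  r+d≮m = <⇒≢ s<r (sym (injective r s r<m (<-trans s<r r<m) (trans eq wrap)))
      where
        s = r + d ∸ m
        s+m≡r+d : s + m ≡ r + d
        s+m≡r+d = m∸n+n≡m (≮⇒≥ r+d≮m)
        wrap : x (r + d) ≡ x s
        wrap = trans (cong x (sym s+m≡r+d)) (periodic s)
        s<r : s < r
        s<r = +-cancelʳ-< m s r (subst (_< r + m) (sym s+m≡r+d) (+-monoʳ-< r d<m))

    apart : ∀ a d → 0 < d → d < m → x a ≢ x (a + d)
    apart a d 0<d d<m eq = apart-from-reduced (a % m) d (m%n<n a m) 0<d d<m (begin
      x (a % m)       ≡⟨ cong x (sym (+-identityʳ (a % m))) ⟩
      x (a % m + 0)   ≡⟨ sym (reduce a 0) ⟩
      x (a + 0)       ≡⟨ cong x (+-identityʳ a) ⟩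
      x a             ≡⟨ eq ⟩
      x (a + d)       ≡⟨ reduce a d ⟩
      x (a % m + d)   ∎)
      where open ≡-Reasoning

    apart-ordered : ∀ a j l → j < l → l < m → x (a + j) ≢ x (a + l)
    apart-ordered a j l j<l l<m eq =
      apart (a + j) (l ∸ j) (m<n⇒0<n∸m j<l) (≤-<-trans (m∸n≤m l j) l<m)
        (trans eq (cong x (trans (cong (a +_) (sym (m+[n∸m]≡n (<⇒≤ j<l))))
                                 (sym (+-assoc a j (l ∸ j))))))

  rotation-injective : ∀ a j l → j < m → l < m → x (a + j) ≡ x (a + l) → j ≡ l
  rotation-injective a j l j<m l<m eq with <-cmp j l
  ... | tri< j<l _ _ = ⊥-elim (apart-ordered a j l j<l l<m eq)
  ... | tri≈ _ j≡l _ = j≡l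
  ... | tri> _ _ l<j = ⊥-elim (apart-ordered a l j l<j j<m (sym eq))

-- An injective sequence of m elements of Fin (m+1) avoiding y meets every
-- vertex other than y: otherwise Fin (m+2) would inject into Fin (m+1).
covers-all-but-one : ∀ {m} (z : ℕ → Fin (suc m)) →
  (∀ j l → j < m → l < m → z j ≡ z l → j ≡ l) →
  (y : Fin (suc m)) → (∀ k → z k ≢ y) →
  ∀ v → v ≡ y ⊎ ∃[ j ] (j < m × v ≡ z j)
covers-all-but-one {m} z z-inj y y∉ v with v F.≟ y | any? (λ (k : Fin m) → v F.≟ z (toℕ k))
... | yes v≡y | _              = inj₁ v≡y
... | no _    | yes (k , v≡zk) = inj₂ (toℕ k , toℕ<n k , v≡zk)
... | no v≢y  | no v∉z         = ⊥-elim (1+n≰n (injective⇒≤ embed-injective))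
  where
    embed : Fin (suc (suc m)) → Fin (suc m)
    embed F.zero             = v
    embed (F.suc F.zero)     = y
    embed (F.suc (F.suc k))  = z (toℕ k)

    embed-injective : Injective _≡_ _≡_ embed
    embed-injective {F.zero}          {F.zero}           _ = refl
    embed-injective {F.zero}          {F.suc F.zero}     e = ⊥-elim (v≢y e)
    embed-injective {F.zero}          {F.suc (F.suc k)}  e = ⊥-elim (v∉z (k , e))
    embed-injective {F.suc F.zero}    {F.zero}           e = ⊥-elim (v≢y (sym e))
    embed-injective {F.suc F.zero}    {F.suc F.zero}     _ = refl
    embed-injective {F.suc F.zero}    {F.suc (F.suc k)}  e = ⊥-elim (y∉ (toℕ k) (sym e))
    embed-injective {F.suc (F.suc k)} {F.zero}           e = ⊥-elim (v∉z (k , sym e))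
    embed-injective {F.suc (F.suc k)} {F.suc F.zero}     e = ⊥-elim (y∉ (toℕ k) e)
    embed-injective {F.suc (F.suc k)} {F.suc (F.suc l)}  e =
      cong (F.suc ∘ F.suc) (toℕ-injective (z-inj _ _ (toℕ<n k) (toℕ<n l) e))

-- The setting of the lemma with n = b + 4: a cycle x of length b + 3 missing
-- only y, and a fixed start vertex x i.  Along the cycle, x (i + (b+1)) is
-- x_{i-2} and x (i + (b+2)) is x_{i-1}.
module AlmostHamiltonianCycle {b : ℕ} (D : Digraph (4 + b)) (dc : DegreeCondition D)
  (x : ℕ → Fin (4 + b)) (cycle : IsCycle D (3 + b) x)
  (y : Fin (4 + b)) (y∉ : ∀ k → x k ≢ y) (i : ℕ) where

  open Digraph D
  open PeriodicSequence (3 + b) x (proj₁ cycle) (proj₁ (proj₂ cycle)) using (rotation-injective)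

  cycle-arc : ∀ l → x (i + l) ⇒ x (i + suc l)
  cycle-arc l = subst (x (i + l) ⇒_) (cong x (sym (+-suc i l))) (proj₂ (proj₂ cycle) (i + l))

  every-vertex : ∀ v → v ≡ y ⊎ ∃[ j ] (j < 3 + b × v ≡ x (i + j))
  every-vertex = covers-all-but-one (λ j → x (i + j)) (rotation-injective i) y (λ k → y∉ (i + k))

  start-distinct : ∀ d → 0 < d → d < 3 + b → x i ≢ x (i + d)
  start-distinct d 0<d d<m eq =
    <⇒≢ 0<d (rotation-injective i 0 d z<s d<m (trans (cong x (+-identityʳ i)) eq))

  PartnerOrLargeDegree : Set
  PartnerOrLargeDegree = PartnerOnPath D x i (suc b) (x i) ⊎ (3 + b ≤ deg D (x i))

  -- A last in-neighbour x (i+l) of x i on the path gives a partner, or makes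
  -- x i non-adjacent to x (i+l+1) with common in-neighbour x (i+l).
  from-last-in-neighbour : ∀ l → 1 ≤ l → l ≤ b →
    x (i + l) ⇒ x i → ¬ (x (i + suc l) ⇒ x i) → PartnerOrLargeDegree
  from-last-in-neighbour l 1≤l l≤b into ¬next with x i ⇒? x (i + suc l)
  ... | yes out = inj₁ (l , 1≤l , l≤b , into , out)
  ... | no ¬out = inj₂ (m≤n⊓o⇒m≤n _ _ (proj₁ (dc _ _ distinct non-adjacent common)))
    where
      distinct : x i ≢ x (i + suc l)
      distinct = start-distinct (suc l) z<s (s≤s (s≤s (m≤n⇒m≤1+n l≤b)))
      non-adjacent : ¬ Adjacent D (x i) (x (i + suc l))
      non-adjacent (inj₁ out)  = ¬out out
      non-adjacent (inj₂ next) = ¬next next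
      common : CommonInNeighbour D (x i) (x (i + suc l))
      common = x (i + l) , into , cycle-arc l

  in-neighbours-off-path : (∀ j → 1 ≤ j → j ≤ suc b → ¬ (x (i + j) ⇒ x i)) →
    ∀ {v} → v ⇒ x i → v ≡ y ⊎ v ≡ x (i + (2 + b))
  in-neighbours-off-path none {v} into with every-vertex v
  ... | inj₁ v≡y = inj₁ v≡y
  ... | inj₂ (zero , _ , v≡) =
    ⊥-elim (loopless (x i) (subst (_⇒ x i) (trans v≡ (cong x (+-identityʳ i))) into))
  ... | inj₂ (suc j , j<m , v≡) with suc j ≤? suc b
  ...   | yes on-path = ⊥-elim (none (suc j) (s≤s z≤n) on-path (subst (_⇒ x i) v≡ into))
  ...   | no off-path =
    inj₂ (trans v≡ (cong (λ k → x (i + k)) (≤-antisym (≤-pred j<m) (≰⇒> off-path))))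

  partner-large-or-few-in-neighbours : ¬ (x (i + suc b) ⇒ x i) →
    PartnerOrLargeDegree ⊎ (∀ {v} → v ⇒ x i → v ≡ y ⊎ v ≡ x (i + (2 + b)))
  partner-large-or-few-in-neighbours ¬prev2 with last-witness (λ j → x (i + j) ⇒? x i) b ¬prev2
  ... | inj₁ none = inj₂ (in-neighbours-off-path none)
  ... | inj₂ (l , 1≤l , l≤b , into , ¬next) = inj₁ (from-last-in-neighbour l 1≤l l≤b into ¬next)

  -- (i): with yx i ∉ D, few in-neighbours would force d⁻(x i) ≤ 1.
  claim-i : 2 ≤ indeg D (x i) → ¬ (y ⇒ x i) → ¬ (x (i + suc b) ⇒ x i) → PartnerOrLargeDegree
  claim-i indeg≥2 ¬y ¬prev2 with partner-large-or-few-in-neighbours ¬prev2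
  ... | inj₁ result = result
  ... | inj₂ few = ⊥-elim (<⇒≱ indeg≥2 (indeg-≤1 D (x (i + (2 + b))) only-prev))
    where
      only-prev : ∀ {u} → u ⇒ x i → u ≡ x (i + (2 + b))
      only-prev into with few into
      ... | inj₁ refl = ⊥-elim (¬y into)
      ... | inj₂ u≡   = u≡

  -- (ii): if x_{i-2} dominates x i take t = b + 1; otherwise use (i), whose
  -- degree alternative contradicts d(x i) ≤ n - 2.
  claim-ii : 2 ≤ indeg D (x i) → ¬ (y ⇒ x i) → deg D (x i) ≤ 2 + b →
    PartnerOnPath D x i (suc b) (x i) ⊎
    ∃[ t ] ((1 ≤ t) × (t ≤ suc b) × (∀ s → t ≤ s → s ≤ suc b → x (i + s) ⇒ x i))
  claim-ii indeg≥2 ¬y small with x (i + suc b) ⇒? x i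
  ... | yes prev2 = inj₂ (suc b , s≤s z≤n , ≤-refl , λ s t≤s s≤t →
          subst (λ k → x (i + k) ⇒ x i) (≤-antisym t≤s s≤t) prev2)
  ... | no ¬prev2 with claim-i indeg≥2 ¬y ¬prev2
  ...   | inj₁ partner = inj₁ partner
  ...   | inj₂ large   = ⊥-elim (<⇒≱ large small)

  -- (iii): few in-neighbours would force d⁻(x i) ≤ 2; the partner found on
  -- C[x_{i+1}, x_{i-2}] also lies on C[x_{i+1}, x_{i-1}].
  claim-iii : ¬ (x (i + suc b) ⇒ x i) → 3 ≤ indeg D (x i) →
    PartnerOnPath D x i (2 + b) (x i) ⊎ (3 + b ≤ deg D (x i))
  claim-iii ¬prev2 indeg≥3 with partner-large-or-few-in-neighbours ¬prev2
  ... | inj₁ (inj₁ partner) = inj₁ (partner-extend D {x} {i} partner)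
  ... | inj₁ (inj₂ large)   = inj₂ large
  ... | inj₂ few = ⊥-elim (<⇒≱ indeg≥3 (indeg-≤2 D y (x (i + (2 + b))) few))

lemma5 : (n : ℕ) → 6 ≤ n → (D : Digraph n) →
    (∀ v → 2 ≤ indeg D v) → (∀ v → 2 ≤ outdeg D v) →
    DegreeCondition D →
    (x : ℕ → Fin n) → IsCycle D (n ∸ 1) x →
    (y : Fin n) → (∀ k → x k ≢ y) →
    (i : ℕ) → 1 ≤ i → i ≤ n ∸ 1 →
    let open Digraph D
        L = n ∸ 1
        xi = x i
        xim2 = x (i + (L ∸ 2))
    in
    ((¬ (y ⇒ xi) → ¬ (xim2 ⇒ xi) →
        PartnerOnPath D x i (L ∸ 2) xi ⊎ (n ∸ 1 ≤ deg D xi)) ×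
     (¬ (y ⇒ xi) → deg D xi ≤ n ∸ 2 →
        PartnerOnPath D x i (L ∸ 2) xi ⊎
        (∃[ t ] ((1 ≤ t) × (t ≤ L ∸ 2) ×
          (∀ s → t ≤ s → s ≤ L ∸ 2 → x (i + s) ⇒ xi)))) ×
     ((y ⇒ xi) → ¬ (xim2 ⇒ xi) → 3 ≤ indeg D xi →
        PartnerOnPath D x i (L ∸ 1) xi ⊎ (n ∸ 1 ≤ deg D xi)))
lemma5 _ (s≤s (s≤s (s≤s (s≤s {n = b} _)))) D indeg≥2 _ dc x cycle y y∉ i _ _ =
  claim-i (indeg≥2 (x i)) , claim-ii (indeg≥2 (x i)) , (λ _ → claim-iii)
  where open AlmostHamiltonianCycle {b} D dc x cycle y y∉ i
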